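{- Let $q$ be a prime power, $1\neq\sigma\in\mathrm{Aut}(\mathbb F_q)$ with fixed field $\mathbb F_s$, $V^*=\mathbb F_q^{n+1}$ (row vectors), $M\in M_{n+1}(q)$ invertible, and $W$ a subspace of $V^*$ with $\dim W=r$. Then the number of points $[\xi]\in\mathrm{PG}(W)$ such that $[\xi^\sigma]=[\xi M]$ is at most $\frac{s^r-1}{s-1}$.
   Context: $\xi^\sigma$ is $\xi$ with $\sigma$ applied to each coordinate; $[\xi^\sigma]=[\xi M]$ means $\xi M$ is a nonzero scalar multiple of $\xi^\sigma$. -}

module Defs where

open import Level using (Level; _⊔_; suc)
open import Algebra.Bundles using (CommutativeRing)
open import Data.Nat using (ℕ; _^_) renaming (suc to ℕsuc)
open import Data.Nat.Primality using (Prime)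
open import Data.Fin using (Fin; _≟_) renaming (suc to fsuc; zero to fzero)
open import Data.Product using (Σ; ∃; ∃₂; _×_; _,_)
open import Data.List using (List)
open import Data.Unit using (⊤)
open import Data.List.Relation.Unary.All using (All)
open import Data.List.Relation.Unary.AllPairs using (AllPairs)
open import Relation.Nullary using (¬_; yes; no)
open import Relation.Binary.PropositionalEquality using (_≡_)

IsPrimePower : ℕ → Set
IsPrimePower q = ∃₂ λ p k → Prime p × q ≡ p ^ ℕsuc k

record Field (c ℓ : Level) : Set (suc (c ⊔ ℓ)) where
  field
    commutativeRing : CommutativeRing c ℓ
  open CommutativeRing commutativeRing public
  field
    0≉1     : ¬ (0# ≈ 1#)
    inverse : ∀ x → ¬ (x ≈ 0#) → ∃ λ y → x * y ≈ 1#

module FieldTheory {c ℓ : Level} (F : Field c ℓ) where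
  open Field F using (Carrier; _≈_; _+_; _*_; 0#; 1#)

  HasSize : (Carrier → Set ℓ) → ℕ → Set (c ⊔ ℓ)
  HasSize P m = Σ (Fin m → Carrier) λ e →
      (∀ i → P (e i))
    × (∀ i j → e i ≈ e j → i ≡ j)
    × (∀ x → P x → ∃ λ i → e i ≈ x)

  HasOrder : ℕ → Set (c ⊔ ℓ)
  HasOrder q = HasSize (λ _ → Level.Lift ℓ ⊤) q

  record IsAutomorphism (σ : Carrier → Carrier) : Set (c ⊔ ℓ) where
    field
      cong    : ∀ {x y} → x ≈ y → σ x ≈ σ y
      +-hom   : ∀ x y → σ (x + y) ≈ σ x + σ y
      *-hom   : ∀ x y → σ (x * y) ≈ σ x * σ y
      1-hom   : σ 1# ≈ 1#
      injective  : ∀ x y → σ x ≈ σ y → x ≈ y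
      surjective : ∀ y → ∃ λ x → σ x ≈ y

  Fixed : (Carrier → Carrier) → Carrier → Set ℓ
  Fixed σ x = σ x ≈ x

  ∑ : ∀ {m} → (Fin m → Carrier) → Carrier
  ∑ {ℕ.zero}  f = 0#
  ∑ {ℕsuc m} f = f fzero + ∑ (λ i → f (fsuc i))

  Vector : ℕ → Set c
  Vector m = Fin m → Carrier

  Matrix : ℕ → Set c
  Matrix m = Fin m → Fin m → Carrier

  _≈ᵥ_ : ∀ {m} → Vector m → Vector m → Set ℓ
  u ≈ᵥ v = ∀ i → u i ≈ v i

  0ᵥ : ∀ {m} → Vector m
  0ᵥ _ = 0#

  _+ᵥ_ : ∀ {m} → Vector m → Vector m → Vector m
  (u +ᵥ v) i = u i + v i

  _·ᵥ_ : ∀ {m} → Carrier → Vector m → Vector m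
  (a ·ᵥ v) i = a * v i

  _^ᵛ_ : ∀ {m} → Vector m → (Carrier → Carrier) → Vector m
  (ξ ^ᵛ σ) i = σ (ξ i)

  _⊛_ : ∀ {m} → Vector m → Matrix m → Vector m
  (ξ ⊛ M) j = ∑ (λ i → ξ i * M i j)

  _⊗_ : ∀ {m} → Matrix m → Matrix m → Matrix m
  (A ⊗ B) i j = ∑ (λ k → A i k * B k j)

  I : ∀ {m} → Matrix m
  I i j with i ≟ j
  ... | yes _ = 1#
  ... | no  _ = 0#

  Invertible : ∀ {m} → Matrix m → Set (c ⊔ ℓ)
  Invertible M = ∃ λ N → (∀ i j → (M ⊗ N) i j ≈ I i j) × (∀ i j → (N ⊗ M) i j ≈ I i j)

  lincomb : ∀ {r m} → (Fin r → Carrier) → (Fin r → Vector m) → Vector m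
  lincomb a b j = ∑ (λ k → a k * b k j)

  record IsSubspace {m} (W : Vector m → Set ℓ) : Set (c ⊔ ℓ) where
    field
      resp  : ∀ {u v} → u ≈ᵥ v → W u → W v
      zero∈ : W 0ᵥ
      +-closed : ∀ {u v} → W u → W v → W (u +ᵥ v)
      ·-closed : ∀ a {v} → W v → W (a ·ᵥ v)

  HasDim : ∀ {m} → (Vector m → Set ℓ) → ℕ → Set (c ⊔ ℓ)
  HasDim {m} W r = Σ (Fin r → Vector m) λ b →
      (∀ k → W (b k))
    × (∀ a → lincomb a b ≈ᵥ 0ᵥ → ∀ k → a k ≈ 0#)
    × (∀ v → W v → ∃ λ a → v ≈ᵥ lincomb a b)

  NonZeroV : ∀ {m} → Vector m → Set ℓ
  NonZeroV v = ¬ (v ≈ᵥ 0ᵥ)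

  SamePoint : ∀ {m} → Vector m → Vector m → Set (c ⊔ ℓ)
  SamePoint u v = ∃ λ a → ¬ (a ≈ 0#) × v ≈ᵥ (a ·ᵥ u)

  DistinctGoodPoints : ∀ {m} → (Vector m → Set ℓ) → (Carrier → Carrier) → Matrix m
                     → List (Vector m) → Set (c ⊔ ℓ)
  DistinctGoodPoints W σ M ξs =
      All (λ ξ → W ξ × NonZeroV ξ × SamePoint (ξ ^ᵛ σ) (ξ ⊛ M)) ξs
    × AllPairs (λ u v → ¬ SamePoint u v) ξs

{-# OPTIONS --safe #-}
-- Call ξ fixed when [ξ^σ] = [ξ M].  We induct on r = dim W, working modulo the span E of fixed
-- points already used: E is invariant under the σ⁻¹-semilinear map ξ ↦ (ξ M)^σ⁻¹, so fixedness
-- makes sense in V/E.  Take a fixed point η ∉ E and pass to V/⟨E, η⟩, where W is spanned by r − 1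
-- of its basis vectors.  The fixed points of V/E that become equal to [x] there lie on the line
-- through [x] and [η], as y = γ x + μ η + δ with δ ∈ E; comparing coefficients in y M ≡ c y^σ shows
-- that the slope μ/γ solves σ ν = κ ν for a κ depending only on x and η, and distinct points have
-- distinct slopes.  The solutions of σ ν = κ ν form {0} or an F_s-line, so each such class has at
-- most s points, and 1 + s (s^(r−1) − 1)/(s − 1) = (s^r − 1)/(s − 1).
module Submission where

open import Level using (Level; _⊔_; lift)
open import Algebra.Bundles using (CommutativeRing)
open import Data.Nat as ℕ using (ℕ; zero; suc; _∸_; _^_; _≤_; z≤n; s≤s) renaming (_*_ to _*ℕ_)
import Data.Nat.Properties as ℕP
open import Data.Fin using (Fin; punchIn; punchOut) renaming (zero to fzero; suc to fsuc)
import Data.Fin.Properties as FinP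
open import Data.List using (List; []; _∷_; length; filter)
import Data.List.Properties as ListP
open import Data.List.Relation.Unary.All as All using (All; []; _∷_)
import Data.List.Relation.Unary.All.Properties as AllP
open import Data.List.Relation.Unary.AllPairs as AllPairs using (AllPairs; []; _∷_)
import Data.List.Relation.Unary.AllPairs.Properties as AllPairsP
open import Data.Product using (Σ; ∃; _×_; _,_; proj₁; proj₂)
open import Data.Empty using (⊥-elim)
open import Function using (_∘_)
open import Relation.Nullary using (¬_; Dec; yes; no; ¬?)
open import Relation.Nullary.Decidable using (_×-dec_)
open import Relation.Binary.PropositionalEquality as ≡ using (_≡_; _≢_)
open import Data.Vec.Functional using () renaming (_∷_ to _◂_)
open import Defs

-- The ring solver normalises polynomials by computing with their coefficients, so these must live
-- in a ring with computable equality; ℤ, mapped canonically into R, serves for any commutative ring.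
module IntegerCoefficientSolver {c ℓ} (R : CommutativeRing c ℓ) where
  open import Data.Integer as ℤ using (ℤ; +_; -[1+_]; _⊖_; sign; ∣_∣; _◃_)
  import Data.Integer.Properties as ℤP
  open import Data.Sign as Sign using (Sign)
  open import Data.Maybe using () renaming (map to mapMaybe)
  open import Relation.Nullary.Decidable using (dec⇒maybe)
  open import Algebra.Solver.Ring.AlmostCommutativeRing
    using (fromCommutativeRing; _-Raw-AlmostCommutative⟶_)
  open CommutativeRing R
  open import Algebra.Properties.Semiring.Mult semiring using (×-homo-+; ×1-homo-*) renaming (_×_ to _×ᵤ_)
  open import Algebra.Properties.Ring ring
    using (-‿involutive; -0#≈0#; -‿+-comm; -1*x≈-x)
  open import Algebra.Properties.CommutativeSemigroup *-commutativeSemigroup using (interchange)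
  open import Relation.Binary.Reasoning.Setoid setoid

  ι : ℕ → Carrier
  ι n = n ×ᵤ 1#

  ⟦_⟧ℤ : ℤ → Carrier
  ⟦ + n ⟧ℤ      = ι n
  ⟦ -[1+ n ] ⟧ℤ = - ι (suc n)

  ⟦_⟧± : Sign → Carrier
  ⟦ Sign.+ ⟧± = 1#
  ⟦ Sign.- ⟧± = - 1#

  [x+y]-[x+z]≈y-z : ∀ x y z → (x + y) - (x + z) ≈ y - z
  [x+y]-[x+z]≈y-z x y z = begin
    (x + y) - (x + z)     ≈⟨ +-congˡ (sym (-‿+-comm x z)) ⟩
    (x + y) + (- x - z)   ≈⟨ +-congʳ (+-comm x y) ⟩
    (y + x) + (- x - z)   ≈⟨ +-assoc y x _ ⟩
    y + (x + (- x - z))   ≈⟨ +-congˡ (sym (+-assoc x (- x) (- z))) ⟩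
    y + ((x - x) - z)     ≈⟨ +-congˡ (+-congʳ (-‿inverseʳ x)) ⟩
    y + (0# - z)          ≈⟨ +-congˡ (+-identityˡ (- z)) ⟩
    y - z                 ∎

  ⊖-homo : ∀ m n → ⟦ m ⊖ n ⟧ℤ ≈ ι m - ι n
  ⊖-homo m       zero    = sym (trans (+-congˡ -0#≈0#) (+-identityʳ _))
  ⊖-homo zero    (suc n) = sym (+-identityˡ _)
  ⊖-homo (suc m) (suc n) = begin
    ⟦ suc m ⊖ suc n ⟧ℤ          ≡⟨ ≡.cong ⟦_⟧ℤ (ℤP.[1+m]⊖[1+n]≡m⊖n m n) ⟩
    ⟦ m ⊖ n ⟧ℤ                  ≈⟨ ⊖-homo m n ⟩
    ι m - ι n                   ≈⟨ sym ([x+y]-[x+z]≈y-z 1# _ _) ⟩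
    ι (suc m) - ι (suc n)       ∎

  +-homo : ∀ i j → ⟦ i ℤ.+ j ⟧ℤ ≈ ⟦ i ⟧ℤ + ⟦ j ⟧ℤ
  +-homo (+ m)    (+ n)    = ×-homo-+ 1# m n
  +-homo (+ m)    -[1+ n ] = ⊖-homo m (suc n)
  +-homo -[1+ m ] (+ n)    = trans (⊖-homo n (suc m)) (+-comm _ _)
  +-homo -[1+ m ] -[1+ n ] = begin
    - ι (suc (suc (m ℕ.+ n)))      ≡⟨ ≡.cong (λ k → - ι (suc k)) (≡.sym (ℕP.+-suc m n)) ⟩
    - ι (suc m ℕ.+ suc n)          ≈⟨ -‿cong (×-homo-+ 1# (suc m) (suc n)) ⟩
    - (ι (suc m) + ι (suc n))      ≈⟨ sym (-‿+-comm _ _) ⟩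
    - ι (suc m) - ι (suc n)        ∎

  -‿homo : ∀ i → ⟦ ℤ.- i ⟧ℤ ≈ - ⟦ i ⟧ℤ
  -‿homo (+ zero)   = sym -0#≈0#
  -‿homo (+ suc n)  = refl
  -‿homo -[1+ n ]   = sym (-‿involutive _)

  ◃-homo : ∀ s n → ⟦ s ◃ n ⟧ℤ ≈ ⟦ s ⟧± * ι n
  ◃-homo s       zero    = sym (zeroʳ _)
  ◃-homo Sign.+ (suc n) = sym (*-identityˡ _)
  ◃-homo Sign.- (suc n) = sym (-1*x≈-x _)

  ±-homo : ∀ s t → ⟦ s Sign.* t ⟧± ≈ ⟦ s ⟧± * ⟦ t ⟧±
  ±-homo Sign.+ t      = sym (*-identityˡ _)
  ±-homo Sign.- Sign.+ = sym (*-identityʳ _)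
  ±-homo Sign.- Sign.- = sym (trans (-1*x≈-x _) (-‿involutive _))

  *-homo : ∀ i j → ⟦ i ℤ.* j ⟧ℤ ≈ ⟦ i ⟧ℤ * ⟦ j ⟧ℤ
  *-homo i j = begin
    ⟦ i ℤ.* j ⟧ℤ                       ≈⟨ ◃-homo (sign i Sign.* sign j) (∣ i ∣ ℕ.* ∣ j ∣) ⟩
    ⟦ sign i Sign.* sign j ⟧± * ι (∣ i ∣ ℕ.* ∣ j ∣)
                                       ≈⟨ *-cong (±-homo (sign i) (sign j)) (×1-homo-* ∣ i ∣ ∣ j ∣) ⟩
    (a * b) * (x * y)                  ≈⟨ interchange a b x y ⟩
    (a * x) * (b * y)                  ≈⟨ sym (*-cong (polar i) (polar j)) ⟩
    ⟦ i ⟧ℤ * ⟦ j ⟧ℤ                    ∎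
    where
    a = ⟦ sign i ⟧±
    b = ⟦ sign j ⟧±
    x = ι ∣ i ∣
    y = ι ∣ j ∣
    polar : ∀ k → ⟦ k ⟧ℤ ≈ ⟦ sign k ⟧± * ι ∣ k ∣
    polar k = trans (reflexive (≡.cong ⟦_⟧ℤ (≡.sym (ℤP.◃-inverse k)))) (◃-homo (sign k) ∣ k ∣)

  ℤ-homomorphism : ℤ.+-*-rawRing -Raw-AlmostCommutative⟶ fromCommutativeRing R
  ℤ-homomorphism = record
    { ⟦_⟧ = ⟦_⟧ℤ ; +-homo = +-homo ; *-homo = *-homo ; -‿homo = -‿homo
    ; 0-homo = refl ; 1-homo = +-identityʳ 1# }

  open import Algebra.Solver.Ring ℤ.+-*-rawRing (fromCommutativeRing R) ℤ-homomorphism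
    (λ i j → mapMaybe (reflexive ∘ ≡.cong ⟦_⟧ℤ) (dec⇒maybe (i ℤP.≟ j))) public

module _ {a d : Level} {A : Set a} (D : A → A → Set d) where

  pigeonhole : ∀ n {t} (T : A → Set t) (label : ∀ z → T z → Fin n) →
               (∀ {z z′} tz tz′ → D z z′ → label z tz ≢ label z′ tz′) →
               ∀ {zs} → All T zs → AllPairs D zs → length zs ≤ n
  pigeonhole n       T label injective {[]}    _          _          = z≤n
  pigeonhole zero    T label injective {z ∷ _} (tz ∷ _)   _          with label z tz
  ... | ()
  pigeonhole (suc n) T label injective {z ∷ _} (tz ∷ tzs) (dz ∷ dzs) =
    s≤s (pigeonhole n T′ label′ injective′ (All.zip (tzs , dz)) dzs)
    where
    T′ : A → Set _
    T′ z′ = T z′ × D z z′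
    label′ : ∀ z′ → T′ z′ → Fin n
    label′ z′ (tz′ , dzz′) = punchOut (injective tz tz′ dzz′)
    injective′ : ∀ {z₁ z₂} t₁ t₂ → D z₁ z₂ → label′ z₁ t₁ ≢ label′ z₂ t₂
    injective′ (t₁ , d₁) (t₂ , d₂) d₁₂ eq =
      injective t₁ t₂ d₁₂ (FinP.punchOut-injective (injective tz t₁ d₁) (injective tz t₂ d₂) eq)

module _ {a r q : Level} {A : Set a} (R : A → A → Set r) (R? : ∀ x y → Dec (R x y))
         (Q : A → A → Set q) (n : ℕ) where

  ClassesBoundedBy : ∀ {p} → (A → Set p) → Set _
  ClassesBoundedBy P = ∀ x ys → P x → All P ys → All (Q x) ys → AllPairs Q ys → All (R x) ys →
                       suc (length ys) ≤ n

  length-filter-split : ∀ x xs →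
    length (filter (R? x) xs) ℕ.+ length (filter (¬? ∘ R? x) xs) ≡ length xs
  length-filter-split x []       = ≡.refl
  length-filter-split x (y ∷ xs) with R? x y
  ... | yes _ = ≡.cong suc (length-filter-split x xs)
  ... | no  _ = ≡.trans (ℕP.+-suc (length (filter (R? x) xs)) _) (≡.cong suc (length-filter-split x xs))

  Representatives : ∀ {p} → (A → Set p) → List A → Set _
  Representatives P xs = Σ (List A) λ L → All P L × AllPairs (λ u v → ¬ R u v) L × length xs ≤ n *ℕ length L

  -- The recursion is on a filtered tail rather than a structural one, hence the fuel.
  representatives-with-fuel : ∀ fuel {p} (P : A → Set p) xs → length xs ≤ fuel →
    All P xs → AllPairs Q xs → ClassesBoundedBy P → Representatives P xs
  representatives-with-fuel _ P [] _ _ _ _ = [] , [] , [] , z≤n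
  representatives-with-fuel (suc fuel) P (x ∷ xs) (s≤s |xs|≤fuel) (px ∷ pxs) (qx ∷ qxs) bounded =
    let L , pL , L-distinct , |others|≤nL =
          representatives-with-fuel fuel P′ others
            (ℕP.≤-trans (ListP.length-filter (¬? ∘ R? x) xs) |xs|≤fuel)
            (All.zip (AllP.filter⁺ (¬? ∘ R? x) pxs , AllP.all-filter (¬? ∘ R? x) xs))
            (AllPairsP.filter⁺ (¬? ∘ R? x) qxs)
            (λ y ys py pys → bounded y ys (proj₁ py) (All.map proj₁ pys))
    in x ∷ L , px ∷ All.map proj₁ pL , All.map proj₂ pL ∷ L-distinct , count L |others|≤nL
    where
    class = filter (R? x) xs
    others = filter (¬? ∘ R? x) xs
    P′ : A → Set _
    P′ y = P y × ¬ R x y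
    |class|<n : suc (length class) ≤ n
    |class|<n = bounded x class px (AllP.filter⁺ (R? x) pxs) (AllP.filter⁺ (R? x) qx)
                  (AllPairsP.filter⁺ (R? x) qxs) (AllP.all-filter (R? x) xs)
    count : ∀ L → length others ≤ n *ℕ length L → suc (length xs) ≤ n *ℕ suc (length L)
    count L |others|≤nL = begin
      suc (length xs)                       ≡⟨ ≡.cong suc (≡.sym (length-filter-split x xs)) ⟩
      suc (length class) ℕ.+ length others  ≤⟨ ℕP.+-mono-≤ |class|<n |others|≤nL ⟩
      n ℕ.+ n *ℕ length L                   ≡⟨ ≡.sym (ℕP.*-suc n (length L)) ⟩
      n *ℕ suc (length L)                   ∎
      where open ℕP.≤-Reasoning

  representatives : ∀ {p} (P : A → Set p) xs → All P xs → AllPairs Q xs → ClassesBoundedBy P →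
                    Representatives P xs
  representatives P xs = representatives-with-fuel (length xs) P xs ℕP.≤-refl

geometric-step : ∀ s S a l → 1 ≤ s → 1 ≤ S → a ≤ s *ℕ l → l *ℕ (s ∸ 1) ≤ S ∸ 1 →
                 suc a *ℕ (s ∸ 1) ≤ s *ℕ S ∸ 1
geometric-step (suc s′) (suc S′) a l _ _ a≤sl ih = begin
  s′ ℕ.+ a *ℕ s′                              ≤⟨ ℕP.+-monoʳ-≤ s′ (ℕP.*-monoˡ-≤ s′ a≤sl) ⟩
  s′ ℕ.+ (l ℕ.+ s′ *ℕ l) *ℕ s′                ≡⟨ ≡.cong (s′ ℕ.+_) (solve 2 (λ s l → (l :+ s :* l) :* s := l :* s :+ s :* (l :* s)) ≡.refl s′ l) ⟩
  s′ ℕ.+ (l *ℕ s′ ℕ.+ s′ *ℕ (l *ℕ s′))        ≤⟨ ℕP.+-monoʳ-≤ s′ (ℕP.+-mono-≤ ih (ℕP.*-monoʳ-≤ s′ ih)) ⟩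
  s′ ℕ.+ (S′ ℕ.+ s′ *ℕ S′)                    ≡⟨ solve 2 (λ s S → s :+ (S :+ s :* S) := S :+ s :* (con 1 :+ S)) ≡.refl s′ S′ ⟩
  S′ ℕ.+ s′ *ℕ suc S′                         ∎
  where
  open ℕP.≤-Reasoning
  open import Data.Nat.Solver using (module +-*-Solver)
  open +-*-Solver

module FieldLemmas {c ℓ} (F : Field c ℓ) where
  open Field F hiding (zero)
  open FieldTheory F
  open IntegerCoefficientSolver commutativeRing using (solve; _:+_; _:*_; _:-_; :-_; _:=_)
  open import Algebra.Properties.Ring ring using (-1*x≈-x; -‿distribˡ-*)
  open import Relation.Binary.Reasoning.Setoid setoid

  inv : ∀ x → x ≉ 0# → Carrier
  inv x x≉0 = proj₁ (inverse x x≉0)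

  *-inverseʳ : ∀ x (x≉0 : x ≉ 0#) → x * inv x x≉0 ≈ 1#
  *-inverseʳ x x≉0 = proj₂ (inverse x x≉0)

  *-inverseˡ : ∀ x (x≉0 : x ≉ 0#) → inv x x≉0 * x ≈ 1#
  *-inverseˡ x x≉0 = trans (*-comm _ _) (*-inverseʳ x x≉0)

  *-cancelʳ-≉0 : ∀ {x y} k → k ≉ 0# → x * k ≈ y * k → x ≈ y
  *-cancelʳ-≉0 {x} {y} k k≉0 xk≈yk = begin
    x                   ≈⟨ sym (*-identityʳ x) ⟩
    x * 1#              ≈⟨ *-congˡ (sym (*-inverseʳ k k≉0)) ⟩
    x * (k * inv k k≉0) ≈⟨ sym (*-assoc x k _) ⟩
    (x * k) * inv k k≉0 ≈⟨ *-congʳ xk≈yk ⟩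
    (y * k) * inv k k≉0 ≈⟨ *-assoc y k _ ⟩
    y * (k * inv k k≉0) ≈⟨ *-congˡ (*-inverseʳ k k≉0) ⟩
    y * 1#              ≈⟨ *-identityʳ y ⟩
    y                   ∎

  *-≉0 : ∀ {x y} → x ≉ 0# → y ≉ 0# → x * y ≉ 0#
  *-≉0 {x} {y} x≉0 y≉0 xy≈0 = y≉0 (*-cancelʳ-≉0 x x≉0 (trans (*-comm y x) (trans xy≈0 (sym (zeroˡ x)))))

  inv-≉0 : ∀ x (x≉0 : x ≉ 0#) → inv x x≉0 ≉ 0#
  inv-≉0 x x≉0 x⁻¹≈0 = 0≉1 (begin
    0#             ≈⟨ sym (zeroʳ x) ⟩
    x * 0#         ≈⟨ *-congˡ (sym x⁻¹≈0) ⟩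
    x * inv x x≉0  ≈⟨ *-inverseʳ x x≉0 ⟩
    1#             ∎)

  ∑-cong : ∀ {m} {f g : Fin m → Carrier} → (∀ i → f i ≈ g i) → ∑ f ≈ ∑ g
  ∑-cong {zero}  f≈g = refl
  ∑-cong {suc m} f≈g = +-cong (f≈g fzero) (∑-cong (f≈g ∘ fsuc))

  ∑-zero : ∀ {m} (f : Fin m → Carrier) → (∀ i → f i ≈ 0#) → ∑ f ≈ 0#
  ∑-zero {zero}  f f≈0 = refl
  ∑-zero {suc m} f f≈0 = trans (+-cong (f≈0 fzero) (∑-zero (f ∘ fsuc) (f≈0 ∘ fsuc))) (+-identityˡ 0#)

  ∑-+ : ∀ {m} (f g : Fin m → Carrier) → ∑ (λ i → f i + g i) ≈ ∑ f + ∑ g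
  ∑-+ {zero}  f g = sym (+-identityˡ 0#)
  ∑-+ {suc m} f g = trans (+-congˡ (∑-+ (f ∘ fsuc) (g ∘ fsuc)))
    (solve 4 (λ a b c d → (a :+ b) :+ (c :+ d) := (a :+ c) :+ (b :+ d)) refl
      (f fzero) (g fzero) (∑ (f ∘ fsuc)) (∑ (g ∘ fsuc)))

  ∑-*ˡ : ∀ {m} a (f : Fin m → Carrier) → ∑ (λ i → a * f i) ≈ a * ∑ f
  ∑-*ˡ {zero}  a f = sym (zeroʳ a)
  ∑-*ˡ {suc m} a f = trans (+-congˡ (∑-*ˡ a (f ∘ fsuc))) (sym (distribˡ a _ _))

  ∑-punchIn : ∀ {m} (j : Fin (suc m)) (f : Fin (suc m) → Carrier) → ∑ f ≈ f j + ∑ (f ∘ punchIn j)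
  ∑-punchIn         fzero    f = refl
  ∑-punchIn {suc m} (fsuc j) f = begin
    f fzero + ∑ (f ∘ fsuc)                                ≈⟨ +-congˡ (∑-punchIn j (f ∘ fsuc)) ⟩
    f fzero + (f (fsuc j) + ∑ (f ∘ fsuc ∘ punchIn j))     ≈⟨ solve 3 (λ a b c → a :+ (b :+ c) := b :+ (a :+ c)) refl _ _ _ ⟩
    f (fsuc j) + (f fzero + ∑ (f ∘ fsuc ∘ punchIn j))     ∎

  lincomb-linear : ∀ {r m} (β β′ : Fin r → Carrier) ρ (b : Fin r → Vector m) j →
                   lincomb (λ k → β k - ρ * β′ k) b j ≈ lincomb β b j - ρ * lincomb β′ b j
  lincomb-linear β β′ ρ b j = begin
    ∑ (λ k → (β k - ρ * β′ k) * b k j)                    ≈⟨ ∑-cong (λ k → solve 4 (λ u R v B → (u :- R :* v) :* B := u :* B :+ (:- R) :* (v :* B)) refl (β k) ρ (β′ k) (b k j)) ⟩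
    ∑ (λ k → β k * b k j + (- ρ) * (β′ k * b k j))        ≈⟨ ∑-+ (λ k → β k * b k j) (λ k → (- ρ) * (β′ k * b k j)) ⟩
    lincomb β b j + ∑ (λ k → (- ρ) * (β′ k * b k j))      ≈⟨ +-congˡ (∑-*ˡ (- ρ) (λ k → β′ k * b k j)) ⟩
    lincomb β b j + (- ρ) * lincomb β′ b j                ≈⟨ +-congˡ (sym (-‿distribˡ-* ρ _)) ⟩
    lincomb β b j - ρ * lincomb β′ b j                    ∎

  _-ᵥ_ : ∀ {m} → Vector m → Vector m → Vector m
  (u -ᵥ v) i = u i - v i

  ≈ᵥ-trans : ∀ {m} {u v w : Vector m} → u ≈ᵥ v → v ≈ᵥ w → u ≈ᵥ w
  ≈ᵥ-trans u≈v v≈w i = trans (u≈v i) (v≈w i)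

  InSpan : ∀ {t m} → (Fin t → Vector m) → Vector m → Set (c ⊔ ℓ)
  InSpan e v = ∃ λ μ → v ≈ᵥ lincomb μ e

  module _ {t m : ℕ} (e : Fin t → Vector m) where

    InSpan-resp : ∀ {u v} → u ≈ᵥ v → InSpan e u → InSpan e v
    InSpan-resp u≈v (μ , u≈μe) = μ , ≈ᵥ-trans (sym ∘ u≈v) u≈μe

    InSpan-zero : ∀ {v} → (∀ i → v i ≈ 0#) → InSpan e v
    InSpan-zero v≈0 = (λ _ → 0#) , λ j → trans (v≈0 j) (sym (∑-zero _ (λ k → zeroˡ (e k j))))

    InSpan-+ : ∀ {u v} → InSpan e u → InSpan e v → InSpan e (u +ᵥ v)
    InSpan-+ (μ , u≈μe) (ν , v≈νe) = (λ k → μ k + ν k) , λ j → begin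
      _                                         ≈⟨ +-cong (u≈μe j) (v≈νe j) ⟩
      lincomb μ e j + lincomb ν e j             ≈⟨ sym (∑-+ (λ k → μ k * e k j) (λ k → ν k * e k j)) ⟩
      ∑ (λ k → μ k * e k j + ν k * e k j)       ≈⟨ ∑-cong (λ k → sym (distribʳ (e k j) (μ k) (ν k))) ⟩
      lincomb (λ k → μ k + ν k) e j             ∎

    InSpan-· : ∀ a {v} → InSpan e v → InSpan e (a ·ᵥ v)
    InSpan-· a (μ , v≈μe) = (λ k → a * μ k) , λ j → begin
      a * _                          ≈⟨ *-congˡ (v≈μe j) ⟩
      a * lincomb μ e j              ≈⟨ sym (∑-*ˡ a (λ k → μ k * e k j)) ⟩
      ∑ (λ k → a * (μ k * e k j))    ≈⟨ ∑-cong (λ k → sym (*-assoc a (μ k) (e k j))) ⟩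
      lincomb (λ k → a * μ k) e j    ∎

    InSpan-- : ∀ {u v} → InSpan e u → InSpan e v → InSpan e (u -ᵥ v)
    InSpan-- u∈ v∈ = InSpan-resp (λ j → +-congˡ (-1*x≈-x _)) (InSpan-+ u∈ (InSpan-· (- 1#) v∈))

    InSpan-·⁻¹ : ∀ {a v} → a ≉ 0# → InSpan e (a ·ᵥ v) → InSpan e v
    InSpan-·⁻¹ {a} {v} a≉0 av∈ = InSpan-resp a⁻¹av≈v (InSpan-· (inv a a≉0) av∈)
      where
      a⁻¹av≈v : ∀ j → inv a a≉0 * (a * v j) ≈ v j
      a⁻¹av≈v j = trans (sym (*-assoc _ a _)) (trans (*-congʳ (*-inverseˡ a a≉0)) (*-identityˡ _))

    InSpan-lincomb : ∀ {u} (μ : Fin u → Carrier) (w : Fin u → Vector m) →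
                     (∀ k → InSpan e (w k)) → InSpan e (lincomb μ w)
    InSpan-lincomb {zero}  μ w w∈ = InSpan-zero (λ j → refl)
    InSpan-lincomb {suc u} μ w w∈ =
      InSpan-+ (InSpan-· (μ fzero) (w∈ fzero)) (InSpan-lincomb (μ ∘ fsuc) (w ∘ fsuc) (w∈ ∘ fsuc))

    InSpan-there : ∀ w {v} → InSpan e v → InSpan (w ◂ e) v
    InSpan-there w (μ , v≈μe) = (0# ◂ μ) , λ j → trans (v≈μe j) (sym (trans (+-congʳ (zeroˡ _)) (+-identityˡ _)))

    InSpan-here : ∀ w → InSpan (w ◂ e) w
    InSpan-here w = (1# ◂ λ _ → 0#) , λ j →
      sym (trans (+-cong (*-identityˡ _) (∑-zero _ (λ k → zeroˡ (e k j)))) (+-identityʳ _))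

  ⊛-cong : ∀ {m} {u v : Vector m} (M : Matrix m) → u ≈ᵥ v → (u ⊛ M) ≈ᵥ (v ⊛ M)
  ⊛-cong M u≈v j = ∑-cong (λ i → *-congʳ (u≈v i))

  ⊛-+ : ∀ {m} (u v : Vector m) (M : Matrix m) → ((u +ᵥ v) ⊛ M) ≈ᵥ ((u ⊛ M) +ᵥ (v ⊛ M))
  ⊛-+ u v M j = trans (∑-cong (λ i → distribʳ (M i j) (u i) (v i))) (∑-+ (λ i → u i * M i j) (λ i → v i * M i j))

  ⊛-· : ∀ {m} a (v : Vector m) (M : Matrix m) → ((a ·ᵥ v) ⊛ M) ≈ᵥ (a ·ᵥ (v ⊛ M))
  ⊛-· a v M j = trans (∑-cong (λ i → *-assoc a (v i) (M i j))) (∑-*ˡ a (λ i → v i * M i j))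

  lincomb-⊛ : ∀ {t m} (μ : Fin t → Carrier) (w : Fin t → Vector m) (M : Matrix m) →
              (lincomb μ w ⊛ M) ≈ᵥ lincomb μ (λ k → w k ⊛ M)
  lincomb-⊛ {zero}  μ w M j = ∑-zero _ (λ i → zeroˡ (M i j))
  lincomb-⊛ {suc t} μ w M j = trans (⊛-+ (μ fzero ·ᵥ w fzero) (lincomb (μ ∘ fsuc) (w ∘ fsuc)) M j)
    (+-cong (⊛-· (μ fzero) (w fzero) M j) (lincomb-⊛ (μ ∘ fsuc) (w ∘ fsuc) M j))

module FiniteField {c ℓ} (F : Field c ℓ) {q : ℕ} (hq : FieldTheory.HasOrder F q) where
  open Field F hiding (zero)
  open FieldTheory F
  open FieldLemmas F

  private
    element : Fin q → Carrier
    element = proj₁ hq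

    index : Carrier → Fin q
    index x = proj₁ (proj₂ (proj₂ (proj₂ hq)) x (lift _))

    element-index : ∀ x → element (index x) ≈ x
    element-index x = proj₂ (proj₂ (proj₂ (proj₂ hq)) x (lift _))

    element-injective : ∀ i j → element i ≈ element j → i ≡ j
    element-injective = proj₁ (proj₂ (proj₂ hq))

  infix 4 _≟_
  _≟_ : ∀ x y → Dec (x ≈ y)
  x ≟ y with index x FinP.≟ index y
  ... | yes eq = yes (trans (sym (element-index x)) (trans (reflexive (≡.cong element eq)) (element-index y)))
  ... | no neq = no (λ x≈y → neq (element-injective _ _ (trans (element-index x) (trans x≈y (sym (element-index y))))))

  ∃? : ∀ {p} (P : Carrier → Set p) → (∀ {x y} → x ≈ y → P x → P y) → (∀ x → Dec (P x)) → Dec (∃ P)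
  ∃? P resp P? with FinP.any? (P? ∘ element)
  ... | yes (i , pi) = yes (element i , pi)
  ... | no ¬any      = no (λ (x , px) → ¬any (index x , resp (sym (element-index x)) px))

  ∃ᵥ? : ∀ t {p} (P : (Fin t → Carrier) → Set p) → (∀ {μ ν} → (∀ k → μ k ≈ ν k) → P μ → P ν) →
        (∀ μ → Dec (P μ)) → Dec (∃ P)
  ∃ᵥ? zero    P resp P? with P? (λ ())
  ... | yes p = yes ((λ ()) , p)
  ... | no ¬p = no (λ (μ , pμ) → ¬p (resp (λ ()) pμ))
  ∃ᵥ? (suc t) P resp P? with ∃? (λ a → ∃ λ μ → P (a ◂ μ)) resp-head
                                 (λ a → ∃ᵥ? t (λ μ → P (a ◂ μ)) (resp ∘ resp-tail) (λ μ → P? (a ◂ μ)))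
    where
    resp-tail : ∀ {a μ ν} → (∀ k → μ k ≈ ν k) → ∀ k → (a ◂ μ) k ≈ (a ◂ ν) k
    resp-tail μ≈ν fzero    = refl
    resp-tail μ≈ν (fsuc k) = μ≈ν k
    resp-head : ∀ {a b} → a ≈ b → ∃ (λ μ → P (a ◂ μ)) → ∃ (λ μ → P (b ◂ μ))
    resp-head a≈b (μ , p) = μ , resp (λ { fzero → a≈b ; (fsuc k) → refl }) p
  ... | yes (a , μ , p) = yes (a ◂ μ , p)
  ... | no ¬p           = no (λ (μ , p) → ¬p (μ fzero , μ ∘ fsuc , resp (λ { fzero → refl ; (fsuc k) → refl }) p))

  InSpan? : ∀ {t m} (e : Fin t → Vector m) v → Dec (InSpan e v)
  InSpan? {t} e v = ∃ᵥ? t (λ μ → v ≈ᵥ lincomb μ e)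
    (λ μ≈ν v≈μe j → trans (v≈μe j) (∑-cong (λ k → *-congʳ (μ≈ν k))))
    (λ μ → FinP.all? (λ j → v j ≟ lincomb μ e j))

module Automorphism {c ℓ} (F : Field c ℓ) {σ : Field.Carrier F → Field.Carrier F}
                    (aut : FieldTheory.IsAutomorphism F σ) where
  open Field F hiding (zero)
  open FieldTheory F
  open FieldLemmas F
  open IsAutomorphism aut renaming (cong to σ-cong)
  open import Algebra.Properties.Ring ring using (x+x≈x⇒x≈0)

  σ-0 : σ 0# ≈ 0#
  σ-0 = x+x≈x⇒x≈0 (σ 0#) (trans (sym (+-hom 0# 0#)) (σ-cong (+-identityˡ 0#)))

  σ-≉0 : ∀ {x} → x ≉ 0# → σ x ≉ 0#
  σ-≉0 x≉0 σx≈0 = x≉0 (injective _ _ (trans σx≈0 (sym σ-0)))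

  σ-inv : ∀ x (x≉0 : x ≉ 0#) → σ (inv x x≉0) * σ x ≈ 1#
  σ-inv x x≉0 = trans (sym (*-hom _ _)) (trans (σ-cong (*-inverseˡ x x≉0)) 1-hom)

  σ-∑ : ∀ {m} (f : Fin m → Carrier) → σ (∑ f) ≈ ∑ (σ ∘ f)
  σ-∑ {zero}  f = σ-0
  σ-∑ {suc m} f = trans (+-hom _ _) (+-congˡ (σ-∑ (f ∘ fsuc)))

  σ⁻¹ : Carrier → Carrier
  σ⁻¹ y = proj₁ (surjective y)

  σ∘σ⁻¹ : ∀ y → σ (σ⁻¹ y) ≈ y
  σ∘σ⁻¹ y = proj₂ (surjective y)

  _^ᶠσ : ∀ {t m} → (Fin t → Vector m) → Fin t → Vector m
  (e ^ᶠσ) k = e k ^ᵛ σ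

  σ-lincomb : ∀ {t m} (μ : Fin t → Carrier) (e : Fin t → Vector m) →
              (lincomb μ e ^ᵛ σ) ≈ᵥ lincomb (σ ∘ μ) (e ^ᶠσ)
  σ-lincomb μ e j = trans (σ-∑ (λ k → μ k * e k j)) (∑-cong (λ k → *-hom (μ k) (e k j)))

  InSpan-σ : ∀ {t m} (e : Fin t → Vector m) {v} → InSpan e v → InSpan (e ^ᶠσ) (v ^ᵛ σ)
  InSpan-σ e (μ , v≈μe) = σ ∘ μ , λ j → trans (σ-cong (v≈μe j)) (σ-lincomb μ e j)

  InSpan-σ⁻¹ : ∀ {t m} (e : Fin t → Vector m) {v} → InSpan (e ^ᶠσ) (v ^ᵛ σ) → InSpan e v
  InSpan-σ⁻¹ e (μ , vσ≈μeσ) = σ⁻¹ ∘ μ , λ j → injective _ _ (trans (vσ≈μeσ j)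
    (sym (trans (σ-lincomb (σ⁻¹ ∘ μ) e j) (∑-cong (λ k → *-congʳ (σ∘σ⁻¹ (μ k)))))))

module FixedField {c ℓ} (F : Field c ℓ) {q : ℕ} (hq : FieldTheory.HasOrder F q)
                  {σ : Field.Carrier F → Field.Carrier F} (aut : FieldTheory.IsAutomorphism F σ)
                  {s : ℕ} (hs : FieldTheory.HasSize F (FieldTheory.Fixed F σ) s) where
  open Field F hiding (zero)
  open FieldTheory F
  open FieldLemmas F
  open FiniteField F hq using (_≟_; ∃?)
  open Automorphism F aut
  open IsAutomorphism aut renaming (cong to σ-cong)
  open IntegerCoefficientSolver commutativeRing using (solve; _:*_; _:=_)
  open import Relation.Binary.Reasoning.Setoid setoid

  private
    fixed-index : ∀ w → σ w ≈ w → Fin s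
    fixed-index w σw≈w = proj₁ (proj₂ (proj₂ (proj₂ hs)) w σw≈w)

    fixed-index-injective : ∀ {w w′} σw≈w σw′≈w′ → fixed-index w σw≈w ≡ fixed-index w′ σw′≈w′ → w ≈ w′
    fixed-index-injective {w} {w′} σw≈w σw′≈w′ eq = begin
      w                                  ≈⟨ sym (proj₂ (proj₂ (proj₂ (proj₂ hs)) w σw≈w)) ⟩
      proj₁ hs (fixed-index w σw≈w)      ≡⟨ ≡.cong (proj₁ hs) eq ⟩
      proj₁ hs (fixed-index w′ σw′≈w′)   ≈⟨ proj₂ (proj₂ (proj₂ (proj₂ hs)) w′ σw′≈w′) ⟩
      w′                                 ∎

  1≤s : 1 ≤ s
  1≤s = ℕ.>-nonZero⁻¹ s {{FinP.nonZeroIndex (fixed-index 1# 1-hom)}}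

  twisted-quotient-fixed : ∀ {κ ν₀ ν} (ν₀≉0 : ν₀ ≉ 0#) → σ ν₀ ≈ κ * ν₀ → σ ν ≈ κ * ν →
                           σ (ν * inv ν₀ ν₀≉0) ≈ ν * inv ν₀ ν₀≉0
  twisted-quotient-fixed {κ} {ν₀} {ν} ν₀≉0 σν₀≈κν₀ σν≈κν = *-cancelʳ-≉0 (σ ν₀) (σ-≉0 ν₀≉0) (begin
    σ w * σ ν₀       ≈⟨ sym (*-hom _ _) ⟩
    σ (w * ν₀)       ≈⟨ σ-cong wν₀≈ν ⟩
    σ ν              ≈⟨ σν≈κν ⟩
    κ * ν            ≈⟨ *-congˡ (sym wν₀≈ν) ⟩
    κ * (w * ν₀)     ≈⟨ solve 3 (λ k w n → k :* (w :* n) := w :* (k :* n)) refl κ w ν₀ ⟩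
    w * (κ * ν₀)     ≈⟨ *-congˡ (sym σν₀≈κν₀) ⟩
    w * σ ν₀         ∎)
    where
    w = ν * inv ν₀ ν₀≉0
    wν₀≈ν : w * ν₀ ≈ ν
    wν₀≈ν = trans (*-assoc _ _ _) (trans (*-congˡ (*-inverseˡ ν₀ ν₀≉0)) (*-identityʳ _))

  -- The solutions of σ ν ≈ κ * ν are either only 0, or ν₀ times the fixed field for any solution ν₀ ≉ 0.
  twisted-fixed-points-bound : ∀ κ → ∀ {a t d} {A : Set a} (T : A → Set t) (D : A → A → Set d)
    (ν : ∀ z → T z → Carrier) → (∀ z tz → σ (ν z tz) ≈ κ * ν z tz) →
    (∀ {z z′} tz tz′ → D z z′ → ν z tz ≉ ν z′ tz′) →
    ∀ {zs} → All T zs → AllPairs D zs → length zs ≤ s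
  twisted-fixed-points-bound κ T D ν σν≈κν ν-injective
    with ∃? (λ ν₀ → ν₀ ≉ 0# × σ ν₀ ≈ κ * ν₀)
            (λ x≈y (x≉0 , σx≈κx) → (λ y≈0 → x≉0 (trans x≈y y≈0)) , trans (σ-cong (sym x≈y)) (trans σx≈κx (*-congˡ x≈y)))
            (λ x → ¬? (x ≟ 0#) ×-dec (σ x ≟ κ * x))
  ... | yes (ν₀ , ν₀≉0 , σν₀≈κν₀) = pigeonhole D s T label label-injective
    where
    w-fixed : ∀ z tz → σ (ν z tz * inv ν₀ ν₀≉0) ≈ ν z tz * inv ν₀ ν₀≉0
    w-fixed z tz = twisted-quotient-fixed ν₀≉0 σν₀≈κν₀ (σν≈κν z tz)
    label : ∀ z → T z → Fin s
    label z tz = fixed-index _ (w-fixed z tz)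
    label-injective : ∀ {z z′} tz tz′ → D z z′ → label z tz ≢ label z′ tz′
    label-injective tz tz′ dzz′ eq = ν-injective tz tz′ dzz′
      (*-cancelʳ-≉0 _ (inv-≉0 ν₀ ν₀≉0) (fixed-index-injective (w-fixed _ tz) (w-fixed _ tz′) eq))
  ... | no ∄ν₀ = at-most-one
    where
    ν≈0 : ∀ z tz → ν z tz ≈ 0#
    ν≈0 z tz with ν z tz ≟ 0#
    ... | yes ν≈0 = ν≈0
    ... | no  ν≉0 = ⊥-elim (∄ν₀ (ν z tz , ν≉0 , σν≈κν z tz))
    at-most-one : ∀ {zs} → All T zs → AllPairs D zs → length zs ≤ s
    at-most-one {[]}         _                  _               = z≤n
    at-most-one {_ ∷ []}     _                  _               = 1≤s
    at-most-one {_ ∷ _ ∷ _}  (tz ∷ tz′ ∷ _)     ((d ∷ _) ∷ _)   =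
      ⊥-elim (ν-injective tz tz′ d (trans (ν≈0 _ tz) (sym (ν≈0 _ tz′))))

module SemilinearFixedPoints {c ℓ} (F : Field c ℓ) {q : ℕ} (hq : FieldTheory.HasOrder F q)
       {σ : Field.Carrier F → Field.Carrier F} (aut : FieldTheory.IsAutomorphism F σ)
       {m : ℕ} (M : FieldTheory.Matrix F m) where
  open Field F hiding (zero)
  open FieldTheory F
  open FieldLemmas F
  open FiniteField F hq using (_≟_; ∃?; InSpan?)
  open Automorphism F aut
  open IsAutomorphism aut renaming (cong to σ-cong)
  open IntegerCoefficientSolver commutativeRing using (solve; _:+_; _:*_; _:-_; :-_; _:=_)
  open import Algebra.Properties.Ring ring
    using (-0#≈0#) renaming (x∙y⁻¹≈ε⇒x≈y to x-y≈0⇒x≈y; x≈y⇒x∙y⁻¹≈ε to x≈y⇒x-y≈0)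
  open import Relation.Binary.Reasoning.Setoid setoid

  private
    V : Set c
    V = Vector m

  -- Read in V/⟨e⟩: [u] = [v], [x^σ] = [x M], x ∈ ⟨b⟩ + ⟨e⟩, and [x] a fixed point of
  -- PG((⟨b⟩ + ⟨e⟩)/⟨e⟩).
  SamePointMod : ∀ {t} → (Fin t → V) → V → V → Set (c ⊔ ℓ)
  SamePointMod e u v = ∃ λ a → a ≉ 0# × InSpan e (v -ᵥ (a ·ᵥ u))

  DistinctMod : ∀ {t} → (Fin t → V) → V → V → Set (c ⊔ ℓ)
  DistinctMod e u v = ¬ SamePointMod e u v

  FixedMod : ∀ {t} → (Fin t → V) → V → Set (c ⊔ ℓ)
  FixedMod e x = ∃ λ a → a ≉ 0# × InSpan (e ^ᶠσ) ((x ⊛ M) -ᵥ (a ·ᵥ (x ^ᵛ σ)))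

  InSpanMod : ∀ {r t} → (Fin r → V) → (Fin t → V) → V → Set (c ⊔ ℓ)
  InSpanMod b e x = ∃ λ β → InSpan e (x -ᵥ lincomb β b)

  FixedPointMod : ∀ {r t} → (Fin r → V) → (Fin t → V) → V → Set (c ⊔ ℓ)
  FixedPointMod b e x = InSpanMod b e x × FixedMod e x × ¬ InSpan e x

  -- ⟨e⟩ is stable under the σ⁻¹-semilinear map ξ ↦ (ξ M)^σ⁻¹, so that it acts on V/⟨e⟩.
  Invariant : ∀ {t} → (Fin t → V) → Set (c ⊔ ℓ)
  Invariant e = ∀ k → InSpan (e ^ᶠσ) (e k ⊛ M)

  SamePointMod? : ∀ {t} (e : Fin t → V) u v → Dec (SamePointMod e u v)
  SamePointMod? e u v = ∃? _ resp (λ a → ¬? (a ≟ 0#) ×-dec InSpan? e (v -ᵥ (a ·ᵥ u)))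
    where
    resp : ∀ {a b} → a ≈ b → a ≉ 0# × InSpan e (v -ᵥ (a ·ᵥ u)) → b ≉ 0# × InSpan e (v -ᵥ (b ·ᵥ u))
    resp a≈b (a≉0 , v-au∈) = (λ b≈0 → a≉0 (trans a≈b b≈0)) , InSpan-resp e (λ j → +-congˡ (-‿cong (*-congʳ a≈b))) v-au∈

  InSpan-⊛ : ∀ {t} {e : Fin t → V} → Invariant e → ∀ {v} → InSpan e v → InSpan (e ^ᶠσ) (v ⊛ M)
  InSpan-⊛ {e = e} inv-e (μ , v≈μe) =
    InSpan-resp (e ^ᶠσ) (λ j → sym (trans (⊛-cong M v≈μe j) (lincomb-⊛ μ e M j)))
      (InSpan-lincomb (e ^ᶠσ) μ (λ k → e k ⊛ M) inv-e)

  Invariant-◂ : ∀ {t} {e : Fin t → V} {η} → Invariant e → FixedMod e η → Invariant (η ◂ e)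
  Invariant-◂ {e = e} {η} inv-e (a , _ , ηM-aησ∈) fzero =
    InSpan-resp ((η ◂ e) ^ᶠσ) (λ j → solve 2 (λ A B → (A :- B) :+ B := A) refl ((η ⊛ M) j) (a * σ (η j)))
      (InSpan-+ eσ′ (InSpan-there (e ^ᶠσ) (η ^ᵛ σ) ηM-aησ∈) (InSpan-· eσ′ a (InSpan-here (e ^ᶠσ) (η ^ᵛ σ))))
    where eσ′ = (η ◂ e) ^ᶠσ
  Invariant-◂ {e = e} {η} inv-e _ (fsuc k) = InSpan-there (e ^ᶠσ) (η ^ᵛ σ) (inv-e k)

  FixedMod-◂ : ∀ {t} {e : Fin t → V} η {x} → FixedMod e x → FixedMod (η ◂ e) x
  FixedMod-◂ {e = e} η (a , a≉0 , xM-axσ∈) = a , a≉0 , InSpan-there (e ^ᶠσ) (η ^ᵛ σ) xM-axσ∈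

  ∉-line : ∀ {t} {e : Fin t → V} {x η} → ¬ InSpan e x → DistinctMod e η x →
           ∀ a → ¬ InSpan e (x -ᵥ (a ·ᵥ η))
  ∉-line {e = e} {x} {η} x∉ x≢η a x-aη∈ with a ≟ 0#
  ... | no  a≉0 = x≢η (a , a≉0 , x-aη∈)
  ... | yes a≈0 = x∉ (InSpan-resp e x-aη≈x x-aη∈)
    where
    x-aη≈x : ∀ j → x j - a * η j ≈ x j
    x-aη≈x j = trans (+-congˡ (trans (-‿cong (trans (*-congʳ a≈0) (zeroˡ _))) -0#≈0#)) (+-identityʳ _)

  ∉-◂ : ∀ {t} {e : Fin t → V} {η x} → ¬ InSpan e x → DistinctMod e η x → ¬ InSpan (η ◂ e) x
  ∉-◂ {e = e} {η} {x} x∉ x≢η (μ , x≈μηe) = ∉-line x∉ x≢η (μ fzero) (μ ∘ fsuc , λ j →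
    trans (+-congʳ (x≈μηe j)) (solve 2 (λ P L → (P :+ L) :- P := L) refl (μ fzero * η j) (lincomb (μ ∘ fsuc) e j)))

  independentMod : ∀ {t} {e : Fin t → V} {x η} → ¬ InSpan e x → ¬ InSpan e η → DistinctMod e η x →
                   ∀ u w → InSpan e ((u ·ᵥ x) +ᵥ (w ·ᵥ η)) → u ≈ 0# × w ≈ 0#
  independentMod {e = e} {x} {η} x∉ η∉ x≢η u w ux+wη∈ = u≈0 , w≈0
    where
    u≈0 : u ≈ 0#
    u≈0 with u ≟ 0#
    ... | yes u≈0 = u≈0
    ... | no  u≉0 = ⊥-elim (∉-line x∉ x≢η (- (u⁻¹ * w)) (InSpan-resp e normalise (InSpan-· e u⁻¹ ux+wη∈)))
      where
      u⁻¹ = inv u u≉0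
      normalise : ∀ j → u⁻¹ * (u * x j + w * η j) ≈ x j - (- (u⁻¹ * w)) * η j
      normalise j = begin
        u⁻¹ * (u * x j + w * η j)               ≈⟨ solve 5 (λ i u x w h → i :* (u :* x :+ w :* h) := (i :* u) :* x :- (:- (i :* w)) :* h) refl u⁻¹ u (x j) w (η j) ⟩
        (u⁻¹ * u) * x j - (- (u⁻¹ * w)) * η j   ≈⟨ +-congʳ (trans (*-congʳ (*-inverseˡ u u≉0)) (*-identityˡ _)) ⟩
        x j - (- (u⁻¹ * w)) * η j               ∎
    w≈0 : w ≈ 0#
    w≈0 with w ≟ 0#
    ... | yes w≈0 = w≈0
    ... | no  w≉0 = ⊥-elim (η∉ (InSpan-·⁻¹ e w≉0 (InSpan-resp e drop-x ux+wη∈)))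
      where
      drop-x : ∀ j → u * x j + w * η j ≈ w * η j
      drop-x j = trans (+-congʳ (trans (*-congʳ u≈0) (zeroˡ _))) (+-identityˡ _)

  independentMod-σ : ∀ {t} {e : Fin t → V} {x η} → ¬ InSpan e x → ¬ InSpan e η → DistinctMod e η x →
                     ∀ u w → InSpan (e ^ᶠσ) ((u ·ᵥ (x ^ᵛ σ)) +ᵥ (w ·ᵥ (η ^ᵛ σ))) → u ≈ 0# × w ≈ 0#
  independentMod-σ {e = e} {x} {η} x∉ η∉ x≢η u w ∈ =
    let u′≈0 , w′≈0 = independentMod x∉ η∉ x≢η (σ⁻¹ u) (σ⁻¹ w) (InSpan-σ⁻¹ e (InSpan-resp (e ^ᶠσ) pull-σ ∈))
    in ≈0 u u′≈0 , ≈0 w w′≈0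
    where
    ≈0 : ∀ a → σ⁻¹ a ≈ 0# → a ≈ 0#
    ≈0 a a′≈0 = trans (sym (σ∘σ⁻¹ a)) (trans (σ-cong a′≈0) σ-0)
    pull-σ : ∀ j → u * σ (x j) + w * σ (η j) ≈ σ (σ⁻¹ u * x j + σ⁻¹ w * η j)
    pull-σ j = sym (trans (+-hom _ _) (+-cong (trans (*-hom _ _) (*-congʳ (σ∘σ⁻¹ u)))
                                               (trans (*-hom _ _) (*-congʳ (σ∘σ⁻¹ w)))))

  module Line {t} {e : Fin t → V} (inv-e : Invariant e)
              {η} (fix-η : FixedMod e η) (η∉ : ¬ InSpan e η)
              {x} (fix-x : FixedMod e x) (x∉ : ¬ InSpan e x) (x≢η : DistinctMod e η x) where

    private
      aη = proj₁ fix-η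
      cx = proj₁ fix-x
      cx≉0 = proj₁ (proj₂ fix-x)

    record Coordinates (y : V) : Set (c ⊔ ℓ) where
      field
        γ μ : Carrier
        γ≉0 : γ ≉ 0#
        δ   : V
        δ∈  : InSpan e δ
        y≈  : ∀ j → y j ≈ (γ * x j + μ * η j) + δ j

      slope : Carrier
      slope = μ * inv γ γ≉0

    coordinates : ∀ {y} → SamePointMod (η ◂ e) x y → Coordinates y
    coordinates {y} (γ , γ≉0 , μ , y-γx≈μηe) = record
      { γ = γ ; μ = μ fzero ; γ≉0 = γ≉0
      ; δ = (y -ᵥ (γ ·ᵥ x)) -ᵥ (μ fzero ·ᵥ η)
      ; δ∈ = μ ∘ fsuc , λ j → trans (+-congʳ (y-γx≈μηe j))
               (solve 2 (λ P L → (P :+ L) :- P := L) refl (μ fzero * η j) (lincomb (μ ∘ fsuc) e j))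
      ; y≈ = λ j → solve 5 (λ Y G X U H → Y := (G :* X :+ U :* H) :+ ((Y :- G :* X) :- U :* H)) refl
                     (y j) γ (x j) (μ fzero) (η j)
      }

    -- Expand y M ≡ cy y^σ modulo ⟨e^σ⟩; x^σ and η^σ are independent there.
    coefficient-relations : ∀ {y} (Y : Coordinates y) (fix-y : FixedMod e y) →
      let open Coordinates Y; cy = proj₁ fix-y in γ * cx ≈ cy * σ γ × μ * aη ≈ cy * σ μ
    coefficient-relations {y} Y (cy , _ , yM-cyyσ∈) =
      let u≈0 , w≈0 = independentMod-σ x∉ η∉ x≢η _ _ (InSpan-resp eσ (λ j → residual (yM j) (yσ j)) combination)
      in x-y≈0⇒x≈y _ _ u≈0 , x-y≈0⇒x≈y _ _ w≈0
      where
      open Coordinates Y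
      eσ : Fin t → V
      eσ = e ^ᶠσ
      combination : InSpan eσ ((((((y ⊛ M) -ᵥ (cy ·ᵥ (y ^ᵛ σ)))
                                   -ᵥ (γ ·ᵥ ((x ⊛ M) -ᵥ (cx ·ᵥ (x ^ᵛ σ)))))
                                   -ᵥ (μ ·ᵥ ((η ⊛ M) -ᵥ (aη ·ᵥ (η ^ᵛ σ)))))
                                   -ᵥ (δ ⊛ M))
                                +ᵥ (cy ·ᵥ (δ ^ᵛ σ)))
      combination = InSpan-+ eσ
        (InSpan-- eσ (InSpan-- eσ (InSpan-- eσ yM-cyyσ∈ (InSpan-· eσ γ (proj₂ (proj₂ fix-x))))
                                  (InSpan-· eσ μ (proj₂ (proj₂ fix-η))))
                     (InSpan-⊛ inv-e δ∈))
        (InSpan-· eσ cy (InSpan-σ e δ∈))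
      yM : ∀ j → (y ⊛ M) j ≈ (γ * (x ⊛ M) j + μ * (η ⊛ M) j) + (δ ⊛ M) j
      yM j = trans (⊛-cong {v = ((γ ·ᵥ x) +ᵥ (μ ·ᵥ η)) +ᵥ δ} M y≈ j)
               (trans (⊛-+ _ δ M j) (+-congʳ (trans (⊛-+ _ _ M j) (+-cong (⊛-· γ x M j) (⊛-· μ η M j)))))
      yσ : ∀ j → σ (y j) ≈ (σ γ * σ (x j) + σ μ * σ (η j)) + σ (δ j)
      yσ j = trans (σ-cong (y≈ j)) (trans (+-hom _ _) (+-congʳ (trans (+-hom _ _) (+-cong (*-hom _ _) (*-hom _ _)))))
      residual : ∀ {YM Yσ XM Xσ HM Hσ DM Dσ} → YM ≈ (γ * XM + μ * HM) + DM → Yσ ≈ (σ γ * Xσ + σ μ * Hσ) + Dσ →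
        ((((YM - cy * Yσ) - γ * (XM - cx * Xσ)) - μ * (HM - aη * Hσ)) - DM) + cy * Dσ
          ≈ (γ * cx - cy * σ γ) * Xσ + (μ * aη - cy * σ μ) * Hσ
      residual {YM} {Yσ} {XM} {Xσ} {HM} {Hσ} {DM} {Dσ} YM≈ Yσ≈ = begin
        _ ≈⟨ +-congʳ (+-congʳ (+-congʳ (+-congʳ (+-cong YM≈ (-‿cong (*-congˡ Yσ≈)))))) ⟩
        ((((((γ * XM + μ * HM) + DM) - cy * ((σ γ * Xσ + σ μ * Hσ) + Dσ)) - γ * (XM - cx * Xσ))
          - μ * (HM - aη * Hσ)) - DM) + cy * Dσ
          ≈⟨ solve 13 (λ XM Xσ HM Hσ DM Dσ g u cy cx a sg su →
               ((((((g :* XM :+ u :* HM) :+ DM) :- cy :* ((sg :* Xσ :+ su :* Hσ) :+ Dσ)) :- g :* (XM :- cx :* Xσ))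
                 :- u :* (HM :- a :* Hσ)) :- DM) :+ cy :* Dσ
               := (g :* cx :- cy :* sg) :* Xσ :+ (u :* a :- cy :* su) :* Hσ)
             refl XM Xσ HM Hσ DM Dσ γ μ cy cx aη (σ γ) (σ μ) ⟩
        (γ * cx - cy * σ γ) * Xσ + (μ * aη - cy * σ μ) * Hσ ∎

    κ : Carrier
    κ = aη * inv cx cx≉0

    slope-twisted-fixed : ∀ {y} (Y : Coordinates y) → FixedMod e y →
                          σ (Coordinates.slope Y) ≈ κ * Coordinates.slope Y
    slope-twisted-fixed Y fix-y@(cy , cy≉0 , _) =
      *-cancelʳ-≉0 (cy * σ γ) (*-≉0 cy≉0 (σ-≉0 γ≉0)) (trans lhs (sym rhs))
      where
      open Coordinates Y
      γcx≈cyσγ = proj₁ (coefficient-relations Y fix-y)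
      μaη≈cyσμ = proj₂ (coefficient-relations Y fix-y)
      γ⁻¹ = inv γ γ≉0
      cx⁻¹ = inv cx cx≉0
      lhs : σ slope * (cy * σ γ) ≈ μ * aη
      lhs = begin
        σ slope * (cy * σ γ)              ≈⟨ *-congʳ (*-hom μ γ⁻¹) ⟩
        (σ μ * σ γ⁻¹) * (cy * σ γ)        ≈⟨ solve 4 (λ a b c d → (a :* b) :* (c :* d) := (c :* a) :* (b :* d)) refl (σ μ) (σ γ⁻¹) cy (σ γ) ⟩
        (cy * σ μ) * (σ γ⁻¹ * σ γ)        ≈⟨ *-cong (sym μaη≈cyσμ) (σ-inv γ γ≉0) ⟩
        (μ * aη) * 1#                     ≈⟨ *-identityʳ _ ⟩
        μ * aη                            ∎
      rhs : κ * slope * (cy * σ γ) ≈ μ * aη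
      rhs = begin
        (aη * cx⁻¹) * (μ * γ⁻¹) * (cy * σ γ)  ≈⟨ *-congˡ (sym γcx≈cyσγ) ⟩
        (aη * cx⁻¹) * (μ * γ⁻¹) * (γ * cx)    ≈⟨ solve 6 (λ a ic u ig g c → (a :* ic) :* (u :* ig) :* (g :* c) := (u :* a) :* ((ic :* c) :* (ig :* g))) refl aη cx⁻¹ μ γ⁻¹ γ cx ⟩
        (μ * aη) * ((cx⁻¹ * cx) * (γ⁻¹ * γ))  ≈⟨ *-congˡ (trans (*-cong (*-inverseˡ cx cx≉0) (*-inverseˡ γ γ≉0)) (*-identityˡ 1#)) ⟩
        (μ * aη) * 1#                         ≈⟨ *-identityʳ _ ⟩
        μ * aη                                ∎

    slope-injective : ∀ {y y′} (Y : Coordinates y) (Y′ : Coordinates y′) →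
                      Coordinates.slope Y ≈ Coordinates.slope Y′ → SamePointMod e y y′
    slope-injective {y} {y′} Y Y′ slope≈ = ρ , *-≉0 Y′.γ≉0 (inv-≉0 γ γ≉0) ,
      InSpan-resp e rearrange (InSpan-- e Y′.δ∈ (InSpan-· e ρ δ∈))
      where
      open Coordinates Y
      module Y′ = Coordinates Y′
      γ⁻¹ = inv γ γ≉0
      ρ = Y′.γ * γ⁻¹
      γ′≈ργ : Y′.γ - ρ * γ ≈ 0#
      γ′≈ργ = x≈y⇒x-y≈0 (sym (trans (*-assoc Y′.γ γ⁻¹ γ) (trans (*-congˡ (*-inverseˡ γ γ≉0)) (*-identityʳ _))))
      μ′≈ρμ : Y′.μ - ρ * μ ≈ 0#
      μ′≈ρμ = x≈y⇒x-y≈0 (sym (begin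
        ρ * μ                                  ≈⟨ solve 3 (λ a b c → (a :* b) :* c := a :* (c :* b)) refl Y′.γ γ⁻¹ μ ⟩
        Y′.γ * slope                           ≈⟨ *-congˡ slope≈ ⟩
        Y′.γ * (Y′.μ * inv Y′.γ Y′.γ≉0)        ≈⟨ solve 3 (λ a b c → a :* (b :* c) := b :* (c :* a)) refl Y′.γ Y′.μ _ ⟩
        Y′.μ * (inv Y′.γ Y′.γ≉0 * Y′.γ)        ≈⟨ *-congˡ (*-inverseˡ Y′.γ Y′.γ≉0) ⟩
        Y′.μ * 1#                              ≈⟨ *-identityʳ _ ⟩
        Y′.μ                                   ∎))
      rearrange : ∀ j → Y′.δ j - ρ * δ j ≈ y′ j - ρ * y j
      rearrange j = sym (begin
        y′ j - ρ * y j
          ≈⟨ +-cong (Y′.y≈ j) (-‿cong (*-congˡ (y≈ j))) ⟩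
        ((Y′.γ * x j + Y′.μ * η j) + Y′.δ j) - ρ * ((γ * x j + μ * η j) + δ j)
          ≈⟨ solve 9 (λ G′ X U′ H D′ R G U D →
               ((G′ :* X :+ U′ :* H) :+ D′) :- R :* ((G :* X :+ U :* H) :+ D)
               := ((G′ :- R :* G) :* X :+ (U′ :- R :* U) :* H) :+ (D′ :- R :* D))
             refl Y′.γ (x j) Y′.μ (η j) (Y′.δ j) ρ γ μ (δ j) ⟩
        ((Y′.γ - ρ * γ) * x j + (Y′.μ - ρ * μ) * η j) + (Y′.δ j - ρ * δ j)
          ≈⟨ +-congʳ (+-cong (trans (*-congʳ γ′≈ργ) (zeroˡ _)) (trans (*-congʳ μ′≈ρμ) (zeroˡ _))) ⟩
        (0# + 0#) + (Y′.δ j - ρ * δ j)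
          ≈⟨ trans (+-congʳ (+-identityˡ 0#)) (+-identityˡ _) ⟩
        Y′.δ j - ρ * δ j ∎)

    line-bound : ∀ {s} → HasSize (Fixed σ) s → ∀ {ys} →
                 All (SamePointMod (η ◂ e) x) ys → All (FixedMod e) ys →
                 All (DistinctMod e x) ys → AllPairs (DistinctMod e) ys →
                 suc (length ys) ≤ s
    line-bound hs on-line fixed x≢ys distinct =
      twisted-fixed-points-bound κ OnLineFixed (DistinctMod e)
        (λ _ (on , _) → slope-of on) (λ _ (on , fix) → slope-twisted-fixed (coordinates on) fix)
        (λ (on , _) (on′ , _) y≢y′ slope≈ → y≢y′ (slope-injective (coordinates on) (coordinates on′) slope≈))
        ((x-on-line , fix-x) ∷ All.zip (on-line , fixed)) (x≢ys ∷ distinct)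
      where
      open FixedField F hq aut hs using (twisted-fixed-points-bound)
      OnLineFixed : V → Set (c ⊔ ℓ)
      OnLineFixed y = SamePointMod (η ◂ e) x y × FixedMod e y
      slope-of : ∀ {y} → SamePointMod (η ◂ e) x y → Carrier
      slope-of on = Coordinates.slope (coordinates on)
      x-on-line : SamePointMod (η ◂ e) x x
      x-on-line = 1# , (λ 1≈0 → 0≉1 (sym 1≈0)) ,
        InSpan-zero (η ◂ e) (λ j → trans (+-congˡ (-‿cong (*-identityˡ (x j)))) (-‿inverseʳ (x j)))

  pivot : ∀ {r t} (b : Fin r → V) {e : Fin t → V} {η} β → InSpan e (η -ᵥ lincomb β b) → ¬ InSpan e η →
          ∃ λ j → β j ≉ 0#
  pivot {r} b {e} {η} β η-βb∈ η∉ = FinP.¬∀⟶∃¬ r _ (λ j → β j ≟ 0#) λ β≈0 →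
    η∉ (InSpan-resp e (λ i → trans (+-congˡ (trans (-‿cong (∑-zero _ (λ k → trans (*-congʳ (β≈0 k)) (zeroˡ _)))) -0#≈0#))
                                   (+-identityʳ _)) η-βb∈)

  InSpanMod-exchange : ∀ {r t} (b : Fin (suc r) → V) {e : Fin t → V} {η x} j βη → βη j ≉ 0# →
                       InSpan e (η -ᵥ lincomb βη b) → InSpanMod b e x → InSpanMod (b ∘ punchIn j) (η ◂ e) x
  InSpanMod-exchange b {e} {η} {x} j βη βηj≉0 η-βηb∈ (β , x-βb∈) =
    β′ , InSpan-resp (η ◂ e) regroup
           (InSpan-+ (η ◂ e) (InSpan-- (η ◂ e) (InSpan-there e η x-βb∈) (InSpan-· (η ◂ e) ρ (InSpan-there e η η-βηb∈)))
                             (InSpan-· (η ◂ e) ρ (InSpan-here e η)))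
    where
    ρ = β j * inv (βη j) βηj≉0
    β′ : Fin _ → Carrier
    β′ k = β (punchIn j k) - ρ * βη (punchIn j k)
    ρβηj≈βj : ρ * βη j - β j ≈ 0#
    ρβηj≈βj = x≈y⇒x-y≈0 (trans (*-assoc (β j) _ (βη j)) (trans (*-congˡ (*-inverseˡ (βη j) βηj≉0)) (*-identityʳ _)))
    regroup : ∀ i → ((x i - lincomb β b i) - ρ * (η i - lincomb βη b i)) + ρ * η i ≈ x i - lincomb β′ (b ∘ punchIn j) i
    regroup i = begin
      ((x i - lincomb β b i) - ρ * (η i - lincomb βη b i)) + ρ * η i
        ≈⟨ +-congʳ (+-cong (+-congˡ (-‿cong (∑-punchIn j (λ k → β k * b k i))))
                           (-‿cong (*-congˡ (+-congˡ (-‿cong (∑-punchIn j (λ k → βη k * b k i))))))) ⟩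
      ((x i - (β j * b j i + L)) - ρ * (η i - (βη j * b j i + L′))) + ρ * η i
        ≈⟨ solve 8 (λ X p B L R H q L′ → ((X :- (p :* B :+ L)) :- R :* (H :- (q :* B :+ L′))) :+ R :* H
                                          := (X :- (L :- R :* L′)) :+ (R :* q :- p) :* B)
             refl (x i) (β j) (b j i) L ρ (η i) (βη j) L′ ⟩
      (x i - (L - ρ * L′)) + (ρ * βη j - β j) * b j i
        ≈⟨ +-congˡ (trans (*-congʳ ρβηj≈βj) (zeroˡ _)) ⟩
      (x i - (L - ρ * L′)) + 0#
        ≈⟨ trans (+-identityʳ _) (+-congˡ (-‿cong (sym (lincomb-linear (β ∘ punchIn j) (βη ∘ punchIn j) ρ (b ∘ punchIn j) i)))) ⟩
      x i - lincomb β′ (b ∘ punchIn j) i ∎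
      where
      L  = lincomb (β ∘ punchIn j) (b ∘ punchIn j) i
      L′ = lincomb (βη ∘ punchIn j) (b ∘ punchIn j) i

  ∅ : Fin 0 → V
  ∅ ()

  Invariant-∅ : Invariant ∅
  Invariant-∅ ()

  FixedPointMod-∅ : ∀ {r} (b : Fin r → V) {ξ} → (∃ λ β → ξ ≈ᵥ lincomb β b) → NonZeroV ξ →
                    SamePoint (ξ ^ᵛ σ) (ξ ⊛ M) → FixedPointMod b ∅ ξ
  FixedPointMod-∅ b (β , ξ≈βb) ξ≉0 (a , a≉0 , ξM≈aξσ) =
    (β , (λ ()) , x≈y⇒x-y≈0 ∘ ξ≈βb) , (a , a≉0 , (λ ()) , x≈y⇒x-y≈0 ∘ ξM≈aξσ) , ξ≉0 ∘ proj₂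

  SamePointMod-∅ : ∀ {u v} → SamePointMod ∅ u v → SamePoint u v
  SamePointMod-∅ (a , a≉0 , _ , v-au≈0) = a , a≉0 , λ j → x-y≈0⇒x≈y _ _ (v-au≈0 j)

  fixed-points-bound : ∀ {s} → HasSize (Fixed σ) s → ∀ r (b : Fin r → V) {t} {e : Fin t → V} → Invariant e →
    ∀ {xs} → All (FixedPointMod b e) xs → AllPairs (DistinctMod e) xs →
    length xs *ℕ (s ∸ 1) ≤ s ^ r ∸ 1
  fixed-points-bound hs r b inv-e {[]} _ _ = z≤n
  fixed-points-bound hs zero b inv-e {η ∷ _} (((βη , η-βηb∈) , _ , η∉) ∷ _) _ with pivot b βη η-βηb∈ η∉
  ... | () , _
  fixed-points-bound {s} hs (suc r) b {e = e} inv-e {η ∷ xs}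
                     (((βη , η-βηb∈) , fix-η , η∉) ∷ fixed) (η≢xs ∷ distinct) =
    geometric-step s (s ^ r) (length xs) (length L) 1≤s (ℕP.m^n>0 s {{ℕ.>-nonZero 1≤s}} r) |xs|≤s|L|
      (fixed-points-bound hs r (b ∘ punchIn j) (Invariant-◂ inv-e fix-η) (All.map proj₁ descends-L) distinct-L)
    where
    open FixedField F hq aut hs using (1≤s)
    j : Fin (suc r)
    j = proj₁ (pivot b βη η-βηb∈ η∉)
    Descends : V → Set (c ⊔ ℓ)
    Descends x = FixedPointMod (b ∘ punchIn j) (η ◂ e) x × FixedMod e x × ¬ InSpan e x × DistinctMod e η x
    descend : ∀ {x} → FixedPointMod b e x × DistinctMod e η x → Descends x
    descend ((x∈ , fix-x , x∉) , x≢η) =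
      (InSpanMod-exchange b j βη (proj₂ (pivot b βη η-βηb∈ η∉)) η-βηb∈ x∈ , FixedMod-◂ η fix-x , ∉-◂ x∉ x≢η) ,
      fix-x , x∉ , x≢η
    line-bounded : ClassesBoundedBy (SamePointMod (η ◂ e)) (SamePointMod? (η ◂ e)) (DistinctMod e) s Descends
    line-bounded x ys (_ , fix-x , x∉ , x≢η) descends-ys x≢ys distinct-ys on-line =
      Line.line-bound inv-e fix-η η∉ fix-x x∉ x≢η hs on-line (All.map (proj₁ ∘ proj₂) descends-ys) x≢ys distinct-ys
    grouped : Representatives (SamePointMod (η ◂ e)) (SamePointMod? (η ◂ e)) (DistinctMod e) s Descends xs
    grouped = representatives (SamePointMod (η ◂ e)) (SamePointMod? (η ◂ e)) (DistinctMod e) s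
                Descends xs (All.zipWith descend (fixed , η≢xs)) distinct line-bounded
    L : List V
    L = proj₁ grouped
    descends-L : All Descends L
    descends-L = proj₁ (proj₂ grouped)
    distinct-L : AllPairs (DistinctMod (η ◂ e)) L
    distinct-L = proj₁ (proj₂ (proj₂ grouped))
    |xs|≤s|L| : length xs ≤ s *ℕ length L
    |xs|≤s|L| = proj₂ (proj₂ (proj₂ grouped))

theorem3p9 : {c ℓ : Level} (F : Field c ℓ) → let open Field F in let open FieldTheory F in
  (q : ℕ) → IsPrimePower q → HasOrder q →
  (σ : Carrier → Carrier) → IsAutomorphism σ → (∃ λ x → ¬ (σ x ≈ x)) →
  (s : ℕ) → HasSize (Fixed σ) s →
  (n : ℕ) (M : Matrix (suc n)) → Invertible M →
  (W : Vector (suc n) → Set ℓ) → IsSubspace W → (r : ℕ) → HasDim W r →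
  (ξs : List (Vector (suc n))) → DistinctGoodPoints W σ M ξs →
  length ξs *ℕ (s ∸ 1) ≤ s ^ r ∸ 1
theorem3p9 F q _ hq σ aut _ s hs n M _ W _ r (b , _ , _ , spans) ξs (good , distinct) =
  fixed-points-bound hs r b {e = ∅} Invariant-∅
    (All.map (λ (ξ∈W , ξ≉0 , fixed) → FixedPointMod-∅ b (spans _ ξ∈W) ξ≉0 fixed) good)
    (AllPairs.map (_∘ SamePointMod-∅) distinct)
  where
  open SemilinearFixedPoints F hq aut M
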